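{- Let $U$ be a countably infinite set and $\mathrm{G}$ a subgroup of $\mathfrak{S}(U)$. Then the cardinality of $\overline{\mathrm{G}}[U]$ is either $1$ or $2^{\aleph_0}$.
   Context: $\overline{\mathrm{G}}$ is the closure of $\mathrm{G}$ in $U^U$ for the function topology: the set of maps $f:U\to U$ such that for every finite $E\subseteq U$ some $g\in\mathrm{G}$ agrees with $f$ on $E$. $\overline{\mathrm{G}}[U]=\{f[U]\mid f\in\overline{\mathrm{G}}\}$ is the set of copies for $\mathrm{G}$. -}

module Defs where

open import Data.Nat using (ℕ)
open import Data.Bool using (Bool)
open import Data.Unit using (⊤)
open import Data.Empty using (⊥)
open import Data.Sum using (_⊎_)
open import Data.Product using (Σ; ∃; _×_; _,_; proj₁; proj₂)
open import Data.List using (List)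
open import Data.List.Membership.Propositional using (_∈_)
open import Function using (_∘_; id; _↔_)
open import Function.Bundles using (Bijection)
open import Relation.Nullary using (¬_)
open import Relation.Binary using (Setoid)
open import Relation.Binary.PropositionalEquality
  using (_≡_; _≗_; refl; sym; trans; setoid; _→-setoid_)

-- Law of excluded middle (the paper works in classical mathematics).
LEM : Set₁
LEM = (P : Set) → P ⊎ ¬ P

CountablyInfinite : Set → Set
CountablyInfinite U = U ↔ ℕ

-- A subgroup G of the symmetric group 𝔖(U), given as a predicate on maps U → U.
-- Closure under two-sided inverses forces every member to be a permutation of U.
record IsSubgroupOfSym (U : Set) (G : (U → U) → Set) : Set₁ where
  field
    has-id  : G id
    has-∘   : ∀ {g h} → G g → G h → G (g ∘ h)
    has-inv : ∀ {g} → G g → Σ (U → U) λ h → G h × (h ∘ g ≗ id) × (g ∘ h ≗ id)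

-- The closure of G in U^U for the function (pointwise convergence) topology:
-- f agrees with some member of G on every finite subset E of U.
InClosure : {U : Set} → ((U → U) → Set) → (U → U) → Set
InClosure {U} G f =
  (E : List U) → Σ (U → U) λ g → G g × (∀ x → x ∈ E → f x ≡ g x)

SameImage : {U : Set} → (U → U) → (U → U) → Set
SameImage {U} f g =
  (x : U) → ((∃ λ y → f y ≡ x) → (∃ λ y → g y ≡ x))
          × ((∃ λ y → g y ≡ x) → (∃ λ y → f y ≡ x))

-- The set of copies Ḡ[U] = { f[U] | f ∈ Ḡ }, as the setoid of closure elements
-- identified when they have the same image.
Copies : (U : Set) → ((U → U) → Set) → Setoid _ _
Copies U G = record
  { Carrier = Σ (U → U) (InClosure G)
  ; _≈_ = λ p q → SameImage (proj₁ p) (proj₁ q)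
  ; isEquivalence = record
    { refl = λ x → id , id
    ; sym = λ e x → proj₂ (e x) , proj₁ (e x)
    ; trans = λ e₁ e₂ x → (proj₁ (e₂ x) ∘ proj₁ (e₁ x)) , (proj₂ (e₁ x) ∘ proj₂ (e₂ x))
    }
  }

HasCardinalityOne : ∀ {c ℓ} → Setoid c ℓ → Set _
HasCardinalityOne S = Bijection S (setoid ⊤)

HasCardinalityContinuum : ∀ {c ℓ} → Setoid c ℓ → Set _
HasCardinalityContinuum S = Bijection S (ℕ →-setoid Bool)

module Submission where

-- If every element of Ḡ is surjective, U is the only copy. Otherwise some f ∈ Ḡ misses a point;
-- correcting f by the inverse of an element of G that agrees with f on a finite set E gives an
-- element of Ḡ fixing E and still missing a point. Along an exhausting increasing sequence of
-- finite sets, each containing the points missed at earlier stages, the infinite composition of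
-- these maps over any subset of the stages lies in Ḡ, and at the first stage where two subsets
-- differ the missed point, pushed through the common prefix, lies in exactly one of the two
-- images. So Ḡ[U] contains 2^ℵ₀ copies, and a copy is determined by its characteristic function
-- on U ≅ ℕ; Schröder–Bernstein finishes.

open import Level using (0ℓ)
open import Data.Nat using (ℕ; zero; suc; _<_; _≤′_; _⊔_; ≤′-refl; ≤′-step)
open import Data.Nat.Properties using (≤⇒≤′; m≤m⊔n; m≤n⊔m; n<1+n; m<n⇒m<1+n)
open import Data.Nat.Induction using (<-rec)
open import Data.Bool using (Bool; true; false; if_then_else_)
open import Data.Unit using (tt)
open import Data.Sum using (_⊎_; inj₁; inj₂)
open import Data.Product using (Σ; ∃; _×_; _,_; proj₁; proj₂)
open import Data.Empty using (⊥-elim)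
open import Data.List using (List; []; _∷_; map)
open import Data.List.Membership.Propositional using (_∈_)
open import Data.List.Membership.Propositional.Properties using (∈-map⁺)
open import Data.List.Relation.Unary.Any using (here; there)
open import Function using (_∘_; id)
open import Function.Bundles using (Inverse; Injection; Bijection; mk⇔)
open import Relation.Nullary using (¬_; Dec; yes; no; does)
open import Relation.Nullary.Decidable using (fromSum; dec-true; does-⇔; decidable-stable)
open import Relation.Binary using (Setoid)
open import Relation.Binary.PropositionalEquality
open import Defs

module SchröderBernstein (lem : LEM) {A B : Setoid 0ℓ 0ℓ} (φ : Injection A B) (ψ : Injection B A) where
  open Setoid A using () renaming (Carrier to A₀; _≈_ to _≈ᴬ_; refl to reflᴬ; sym to symᴬ; trans to transᴬ)
  open Setoid B using () renaming (Carrier to B₀; _≈_ to _≈ᴮ_; sym to symᴮ; trans to transᴮ)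
  open Injection φ using () renaming (to to Φ; cong to Φ-cong; injective to Φ-injective)
  open Injection ψ using () renaming (to to Ψ; cong to Ψ-cong; injective to Ψ-injective)

  ΦΨ^ : ℕ → B₀ → B₀
  ΦΨ^ zero    b = b
  ΦΨ^ (suc n) b = Φ (Ψ (ΦΨ^ n b))

  -- a is sent back along Ψ exactly when its chain of Φ/Ψ-preimages starts in B ∖ Φ[A].
  BackChain : A₀ → Set
  BackChain a = Σ B₀ λ b → Σ ℕ λ n → ¬ (Σ A₀ λ a' → Φ a' ≈ᴮ b) × (a ≈ᴬ Ψ (ΦΨ^ n b))

  BackChain-resp : ∀ {a a'} → a ≈ᴬ a' → BackChain a → BackChain a'
  BackChain-resp a≈a' (b , n , b∉ , a≈) = b , n , b∉ , transᴬ (symᴬ a≈a') a≈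

  h′ : (a : A₀) → BackChain a ⊎ ¬ BackChain a → B₀
  h′ a (inj₁ (b , n , _)) = ΦΨ^ n b
  h′ a (inj₂ _)           = Φ a

  h : A₀ → B₀
  h a = h′ a (lem (BackChain a))

  h-cong : ∀ {a a'} → a ≈ᴬ a' → h a ≈ᴮ h a'
  h-cong {a} {a'} a≈a' with lem (BackChain a) | lem (BackChain a')
  ... | inj₁ (_ , _ , _ , a≈) | inj₁ (_ , _ , _ , a'≈) = Ψ-injective (transᴬ (symᴬ a≈) (transᴬ a≈a' a'≈))
  ... | inj₁ c  | inj₂ ¬c = ⊥-elim (¬c (BackChain-resp a≈a' c))
  ... | inj₂ ¬c | inj₁ c  = ⊥-elim (¬c (BackChain-resp (symᴬ a≈a') c))
  ... | inj₂ _  | inj₂ _  = Φ-cong a≈a'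

  h′-separates : ∀ {a a'} (c : BackChain a) → ¬ BackChain a' → ¬ (h′ a (inj₁ c) ≈ᴮ Φ a')
  h′-separates (b , zero  , b∉ , _) _   eq = b∉ (_ , symᴮ eq)
  h′-separates (b , suc n , b∉ , _) ¬c' eq = ¬c' (b , n , b∉ , symᴬ (Φ-injective eq))

  h-injective : ∀ {a a'} → h a ≈ᴮ h a' → a ≈ᴬ a'
  h-injective {a} {a'} eq with lem (BackChain a) | lem (BackChain a')
  ... | inj₁ (_ , _ , _ , a≈) | inj₁ (_ , _ , _ , a'≈) = transᴬ a≈ (transᴬ (Ψ-cong eq) (symᴬ a'≈))
  ... | inj₁ c  | inj₂ ¬c = ⊥-elim (h′-separates c ¬c eq)
  ... | inj₂ ¬c | inj₁ c  = ⊥-elim (h′-separates c ¬c (symᴮ eq))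
  ... | inj₂ _  | inj₂ _  = Φ-injective eq

  h-surjective : ∀ b → ∃ λ a → ∀ {a'} → a' ≈ᴬ a → h a' ≈ᴮ b
  h-surjective b with lem (BackChain (Ψ b))
  ... | inj₁ c = Ψ b , via-Ψ
    where
    via-Ψ : ∀ {a'} → a' ≈ᴬ Ψ b → h a' ≈ᴮ b
    via-Ψ {a'} a'≈ with lem (BackChain a')
    ... | inj₁ (_ , _ , _ , a'≈') = Ψ-injective (transᴬ (symᴬ a'≈') a'≈)
    ... | inj₂ ¬c = ⊥-elim (¬c (BackChain-resp (symᴬ a'≈) c))
  ... | inj₂ ¬c with lem (Σ A₀ λ a → Φ a ≈ᴮ b)
  ...   | inj₂ b∉ = ⊥-elim (¬c (b , zero , b∉ , reflᴬ))
  ...   | inj₁ (a , Φa≈b) = a , via-Φ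
    where
    via-Φ : ∀ {a'} → a' ≈ᴬ a → h a' ≈ᴮ b
    via-Φ {a'} a'≈a with lem (BackChain a')
    ... | inj₁ (b' , n , b'∉ , a'≈) =
      ⊥-elim (¬c (b' , suc n , b'∉ , Ψ-cong (transᴮ (symᴮ Φa≈b) (Φ-cong (transᴬ (symᴬ a'≈a) a'≈)))))
    ... | inj₂ _ = transᴮ (Φ-cong a'≈a) Φa≈b

  bijection : Bijection A B
  bijection = record { to = h ; cong = h-cong ; bijective = h-injective , h-surjective }

schröder-bernstein : LEM → {A B : Setoid 0ℓ 0ℓ} → Injection A B → Injection B A → Bijection A B
schröder-bernstein lem φ ψ = SchröderBernstein.bijection lem φ ψ

Image : {U : Set} → (U → U) → U → Set
Image f x = ∃ λ y → f y ≡ x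

SameImage-sym : {U : Set} {f g : U → U} → SameImage f g → SameImage g f
SameImage-sym same x = proj₂ (same x) , proj₁ (same x)

≗⇒SameImage : {U : Set} {f g : U → U} → f ≗ g → SameImage f g
≗⇒SameImage f≗g x = (λ (y , fy≡x) → y , trans (sym (f≗g y)) fy≡x)
                  , (λ (y , gy≡x) → y , trans (f≗g y) gy≡x)

does-≡⇒ : {A B : Set} (a? : Dec A) (b? : Dec B) → does a? ≡ does b? → A → B
does-≡⇒ a? (yes b)  _   _ = b
does-≡⇒ a? (no _)   eq a with () ← trans (sym (dec-true a? a)) eq

module _ (lem : LEM) {U : Set} (enum : CountablyInfinite U) (G : (U → U) → Set) where
  open Inverse enum using () renaming (to to encode; from to decode; strictlyInverseʳ to decode-encode)

  image? : (f : U → U) (x : U) → Dec (Image f x)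
  image? f x = fromSum (lem (Image f x))

  image-code : (U → U) → ℕ → Bool
  image-code f n = does (image? f (decode n))

  image-code-injective : ∀ {f g} → image-code f ≗ image-code g → ∀ {x} → Image f x → Image g x
  image-code-injective {f} {g} same {x} x∈f[U] =
    subst (Image g) (decode-encode x)
      (does-≡⇒ (image? f _) (image? g _) (same (encode x)) (subst (Image f) (sym (decode-encode x)) x∈f[U]))

  copies↣cantor : Injection (Copies U G) (ℕ →-setoid Bool)
  copies↣cantor = record
    { to = image-code ∘ proj₁
    ; cong = λ same n → does-⇔ (mk⇔ (proj₁ (same (decode n))) (proj₂ (same (decode n)))) (image? _ _) (image? _ _)
    ; injective = λ same x → image-code-injective same , image-code-injective (sym ∘ same)
    }

compose : {U : Set} → (ℕ → U → U) → ℕ → U → U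
compose c zero    = id
compose c (suc n) = compose c n ∘ c n

compose-cong : {U : Set} {c c' : ℕ → U → U} →
               ∀ n → (∀ {j} → j < n → c j ≡ c' j) → compose c n ≡ compose c' n
compose-cong zero    _     = refl
compose-cong (suc n) c≡c' =
  cong₂ (λ f g → f ∘ g) (compose-cong n (c≡c' ∘ m<n⇒m<1+n)) (c≡c' (n<1+n n))

-- Since c n fixes Es n, compose c n x is eventually constant in n; limit is c 0 ∘ c 1 ∘ c 2 ∘ ⋯.
module InfiniteComposition {U : Set} (Es : ℕ → List U) (Es-step : ∀ {n x} → x ∈ Es n → x ∈ Es (suc n))
             (rank : U → ℕ) (∈-Es-rank : ∀ x → x ∈ Es (rank x))
             (c : ℕ → U → U) (c-fixes : ∀ {n x} → x ∈ Es n → c n x ≡ x) where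

  Es-mono : ∀ {m n x} → m ≤′ n → x ∈ Es m → x ∈ Es n
  Es-mono ≤′-refl       x∈ = x∈
  Es-mono (≤′-step m≤n) x∈ = Es-step (Es-mono m≤n x∈)

  compose-stable : ∀ {m n x} → m ≤′ n → x ∈ Es m → compose c n x ≡ compose c m x
  compose-stable ≤′-refl                  _  = refl
  compose-stable {n = suc n} (≤′-step m≤n) x∈ =
    trans (cong (compose c n) (c-fixes (Es-mono m≤n x∈))) (compose-stable m≤n x∈)

  compose-factors : ∀ {m n} → m ≤′ n → ∀ y → Image (compose c m) (compose c n y)
  compose-factors ≤′-refl                   y = y , refl
  compose-factors {n = suc n} (≤′-step m≤n) y = compose-factors m≤n (c n y)

  limit : U → U
  limit x = compose c (rank x) x

  limit-agrees : ∀ {m x} → x ∈ Es m → limit x ≡ compose c m x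
  limit-agrees {m} {x} x∈ =
    trans (sym (compose-stable (≤⇒≤′ (m≤m⊔n (rank x) m)) (∈-Es-rank x)))
          (compose-stable (≤⇒≤′ (m≤n⊔m (rank x) m)) x∈)

  limit-factors : ∀ m y → Image (compose c m) (limit y)
  limit-factors m y with compose-factors (≤⇒≤′ (m≤n⊔m (rank y) m)) y
  ... | z , eq = z , trans eq (compose-stable (≤⇒≤′ (m≤m⊔n (rank y) m)) (∈-Es-rank y))

  bound : List U → ℕ
  bound []      = 0
  bound (x ∷ E) = rank x ⊔ bound E

  ∈-Es-bound : ∀ {E x} → x ∈ E → x ∈ Es (bound E)
  ∈-Es-bound {y ∷ E} (here refl) = Es-mono (≤⇒≤′ (m≤m⊔n (rank y) (bound E))) (∈-Es-rank y)
  ∈-Es-bound {y ∷ E} (there x∈)  = Es-mono (≤⇒≤′ (m≤n⊔m (rank y) (bound E))) (∈-Es-bound x∈)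

module _ {U : Set} {G : (U → U) → Set} (G≤𝔖 : IsSubgroupOfSym U G) where
  open IsSubgroupOfSym G≤𝔖

  G⊆closure : ∀ {g} → G g → InClosure G g
  G⊆closure g∈G E = _ , g∈G , λ _ _ → refl

  closure-id : InClosure G id
  closure-id = G⊆closure has-id

  closure-∘ : ∀ {f g} → InClosure G f → InClosure G g → InClosure G (f ∘ g)
  closure-∘ {f} {g} f∈Ḡ g∈Ḡ E with g∈Ḡ E
  ... | g' , g'∈G , g≈g' with f∈Ḡ (map g E)
  ... | f' , f'∈G , f≈f' =
    f' ∘ g' , has-∘ f'∈G g'∈G , λ x x∈ → trans (f≈f' (g x) (∈-map⁺ g x∈)) (cong f' (g≈g' x x∈))

  closure-injective : ∀ {f} → InClosure G f → ∀ {x y} → f x ≡ f y → x ≡ y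
  closure-injective {f} f∈Ḡ {x} {y} fx≡fy with f∈Ḡ (x ∷ y ∷ [])
  ... | g , g∈G , f≈g with has-inv g∈G
  ... | g⁻¹ , _ , g⁻¹g≗id , _ = begin
    x           ≡⟨ sym (g⁻¹g≗id x) ⟩
    g⁻¹ (g x)   ≡⟨ cong g⁻¹ (trans (sym (f≈g x (here refl))) (trans fx≡fy (f≈g y (there (here refl))))) ⟩
    g⁻¹ (g y)   ≡⟨ g⁻¹g≗id y ⟩
    y           ∎
    where open ≡-Reasoning

  closure-compose : ∀ {c} → (∀ n → InClosure G (c n)) → ∀ n → InClosure G (compose c n)
  closure-compose c∈Ḡ zero    = closure-id
  closure-compose c∈Ḡ (suc n) = closure-∘ (closure-compose c∈Ḡ n) (c∈Ḡ n)

  closure-closed : ∀ {f} → (∀ E → Σ (U → U) λ p → InClosure G p × (∀ x → x ∈ E → f x ≡ p x)) →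
                   InClosure G f
  closure-closed approx E with approx E
  ... | p , p∈Ḡ , f≈p with p∈Ḡ E
  ... | g , g∈G , p≈g = g , g∈G , λ x x∈ → trans (f≈p x x∈) (p≈g x x∈)

  non-surjective-fixing : ∀ {f a} → InClosure G f → ¬ Image f a → ∀ E →
    Σ (U → U) λ d → InClosure G d × (∀ {x} → x ∈ E → d x ≡ x) × Σ U λ b → ¬ Image d b
  non-surjective-fixing {f} {a} f∈Ḡ a∉f[U] E with f∈Ḡ E
  ... | g , g∈G , f≈g with has-inv g∈G
  ... | g⁻¹ , g⁻¹∈G , g⁻¹g≗id , gg⁻¹≗id =
    g⁻¹ ∘ f , closure-∘ (G⊆closure g⁻¹∈G) f∈Ḡ
            , (λ {x} x∈ → trans (cong g⁻¹ (f≈g x x∈)) (g⁻¹g≗id x))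
            , g⁻¹ a , λ (y , eq) → a∉f[U] (y , trans (sym (gg⁻¹≗id (f y))) (trans (cong g eq) (gg⁻¹≗id a)))

  single-copy : (∀ {f} → InClosure G f → ∀ x → Image f x) → HasCardinalityOne (Copies U G)
  single-copy surjective = record
    { to = λ _ → tt
    ; cong = λ _ → refl
    ; bijective = (λ {(f , f∈Ḡ)} {(g , g∈Ḡ)} _ x → (λ _ → surjective g∈Ḡ x) , (λ _ → surjective f∈Ḡ x))
                , (λ _ → (id , closure-id) , λ _ → refl)
    }

  module CantorEmbedding (enum : CountablyInfinite U) {f a} (f∈Ḡ : InClosure G f) (a∉f[U] : ¬ Image f a) where
    open Inverse enum using () renaming (to to encode; from to decode; strictlyInverseʳ to decode-encode)

    fixer : List U → U → U
    fixer E = proj₁ (non-surjective-fixing f∈Ḡ a∉f[U] E)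

    fixer-closure : ∀ E → InClosure G (fixer E)
    fixer-closure E = proj₁ (proj₂ (non-surjective-fixing f∈Ḡ a∉f[U] E))

    fixer-fixes : ∀ E {x} → x ∈ E → fixer E x ≡ x
    fixer-fixes E = proj₁ (proj₂ (proj₂ (non-surjective-fixing f∈Ḡ a∉f[U] E)))

    missed : List U → U
    missed E = proj₁ (proj₂ (proj₂ (proj₂ (non-surjective-fixing f∈Ḡ a∉f[U] E))))

    missed-∉ : ∀ E → ¬ Image (fixer E) (missed E)
    missed-∉ E = proj₂ (proj₂ (proj₂ (proj₂ (non-surjective-fixing f∈Ḡ a∉f[U] E))))

    -- Later fixers fix the points missed earlier, so the point missed at stage n stays missed.
    Es : ℕ → List U
    Es zero    = []
    Es (suc n) = decode n ∷ missed (Es n) ∷ Es n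

    ∈-Es-rank : ∀ x → x ∈ Es (suc (encode x))
    ∈-Es-rank x = here (sym (decode-encode x))

    choose : ℕ → Bool → U → U
    choose n b = if b then fixer (Es n) else id

    select : (ℕ → Bool) → ℕ → U → U
    select σ n = choose n (σ n)

    select-closure : ∀ σ n → InClosure G (select σ n)
    select-closure σ n with σ n
    ... | true  = fixer-closure (Es n)
    ... | false = closure-id

    select-fixes : ∀ σ {n x} → x ∈ Es n → select σ n x ≡ x
    select-fixes σ {n} x∈ with σ n
    ... | true  = fixer-fixes (Es n) x∈
    ... | false = refl

    module L (σ : ℕ → Bool) = InfiniteComposition Es (there ∘ there) (suc ∘ encode) ∈-Es-rank (select σ) (select-fixes σ)

    copy : (ℕ → Bool) → U → U
    copy = L.limit

    copy-closure : ∀ σ → InClosure G (copy σ)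
    copy-closure σ = closure-closed λ E →
      compose (select σ) (bound E) , closure-compose (select-closure σ) (bound E) , λ _ x∈ → limit-agrees (∈-Es-bound x∈)
      where open L σ

    copy-cong : ∀ {σ τ} → σ ≗ τ → copy σ ≗ copy τ
    copy-cong {σ} {τ} σ≗τ x =
      cong-app (compose-cong (suc (encode x)) λ {j} _ → cong (choose j) (σ≗τ j)) x

    image-excludes-missed : ∀ {σ n} → σ n ≡ true → ¬ Image (copy σ) (compose (select σ) n (missed (Es n)))
    image-excludes-missed {σ} {n} σn (y , copyσy≡) with L.limit-factors σ (suc n) y
    ... | z , eq = missed-∉ (Es n) (z , closure-injective (closure-compose (select-closure σ) n) (begin
      compose (select σ) n (fixer (Es n) z)   ≡⟨ cong (λ b → compose (select σ) n (choose n b z)) (sym σn) ⟩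
      compose (select σ) (suc n) z            ≡⟨ eq ⟩
      copy σ y                                ≡⟨ copyσy≡ ⟩
      compose (select σ) n (missed (Es n))    ∎))
      where open ≡-Reasoning

    image-includes-missed : ∀ {σ n} → σ n ≡ false → Image (copy σ) (compose (select σ) n (missed (Es n)))
    image-includes-missed {σ} {n} σn = missed (Es n) , (begin
      copy σ (missed (Es n))                              ≡⟨ L.limit-agrees σ (there (here refl)) ⟩
      compose (select σ) n (select σ n (missed (Es n)))   ≡⟨ cong (λ b → compose (select σ) n (choose n b (missed (Es n)))) σn ⟩
      compose (select σ) n (missed (Es n))                ∎)
      where open ≡-Reasoning

    first-difference-separates : ∀ {σ τ n} → (∀ {j} → j < n → σ j ≡ τ j) → σ n ≡ true → τ n ≡ false →
                                 ¬ SameImage (copy σ) (copy τ)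
    first-difference-separates {σ} {τ} {n} agree σn τn same =
      image-excludes-missed {σ} σn (proj₂ (same _) missed-in-copyτ)
      where
      prefix : compose (select σ) n ≡ compose (select τ) n
      prefix = compose-cong n λ {j} j<n → cong (choose j) (agree j<n)
      missed-in-copyτ : Image (copy τ) (compose (select σ) n (missed (Es n)))
      missed-in-copyτ = subst (λ p → Image (copy τ) (p (missed (Es n)))) (sym prefix) (image-includes-missed {τ} τn)

    copy-injective : ∀ {σ τ} → SameImage (copy σ) (copy τ) → σ ≗ τ
    copy-injective {σ} {τ} same = <-rec (λ n → σ n ≡ τ n) agree-at
      where
      agree-at : ∀ n → (∀ {j} → j < n → σ j ≡ τ j) → σ n ≡ τ n
      agree-at n agree with σ n in σn | τ n in τn
      ... | true  | true  = refl
      ... | false | false = refl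
      ... | true  | false = ⊥-elim (first-difference-separates agree σn τn same)
      ... | false | true  = ⊥-elim (first-difference-separates (sym ∘ agree) τn σn (SameImage-sym same))

    cantor↣copies : Injection (ℕ →-setoid Bool) (Copies U G)
    cantor↣copies = record
      { to = λ σ → copy σ , copy-closure σ
      ; cong = ≗⇒SameImage ∘ copy-cong
      ; injective = copy-injective
      }

theorem5p5 : LEM → (U : Set) → CountablyInfinite U →
    (G : (U → U) → Set) → IsSubgroupOfSym U G →
    HasCardinalityOne (Copies U G) ⊎ HasCardinalityContinuum (Copies U G)
theorem5p5 lem U enum G G≤𝔖 with lem (Σ (U → U) λ f → InClosure G f × Σ U λ a → ¬ Image f a)
... | inj₁ (f , f∈Ḡ , a , a∉f[U]) =
  inj₂ (schröder-bernstein lem (copies↣cantor lem enum G) (CantorEmbedding.cantor↣copies G≤𝔖 enum f∈Ḡ a∉f[U]))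
... | inj₂ all-surjective =
  inj₁ (single-copy G≤𝔖 λ {f} f∈Ḡ x →
    decidable-stable (fromSum (lem (Image f x))) λ x∉f[U] → all-surjective (f , f∈Ḡ , x , x∉f[U]))
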